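{- For every $n\ge 1$, $|M_n|=3^{\frac{3^n-1}{2}}\,2^{3^{n-1}}$.
   Context: Let $X=\{0,1,2\}$ and let $\mathcal T$ be the rooted ternary tree whose vertices are the finite words over $X$ (the children of $w$ are $w0,w1,w2$); $\mathcal T_n$ is the tree truncated at level $n$, with $\mathrm{Aut}(\mathcal T_1)=S_3$. Automorphisms act on the right, written $(w)\sigma$, and $\sigma\tau$ means first $\sigma$ then $\tau$. For $n\ge2$ every $\sigma\in\mathrm{Aut}(\mathcal T_n)$ is written uniquely as $\sigma=(\sigma_0,\sigma_1,\sigma_2)\pi$ with $\pi\in S_3$, $\sigma_i\in\mathrm{Aut}(\mathcal T_{n-1})$, meaning $(iw)\sigma=((i)\pi)((w)\sigma_i)$; hence $(\sigma_0,\sigma_1,\sigma_2)\pi\cdot(\tau_0,\tau_1,\tau_2)\rho=(\sigma_0\tau_{(0)\pi},\sigma_1\tau_{(1)\pi},\sigma_2\tau_{(2)\pi})\pi\rho$; write $(\sigma_0,\sigma_1,\sigma_2)$ when $\pi=\mathrm{id}$. $\mathrm{Aut}(\mathcal T_{n-1})$ is embedded in $\mathrm{Aut}(\mathcal T_n)$ via $\sigma\mapsto(\sigma,\mathrm{id},\mathrm{id})$. Define $x_1=(0,1,2)$, $y_1=(0,1)$, $z_1=\mathrm{id}$, and for $n\ge2$: $x_n=(\mathrm{id},\mathrm{id},x_{n-1})(0,1,2)$, $y_n=(\mathrm{id},y_{n-1},x_{n-1})(0,1)$, $z_n=(y_{n-1},y_{n-1},x_{n-1})$. Let $L_1=\langle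 x_1\rangle$, $M_1=S_3$, and for $n\ge2$: $L_n=\langle x_n,z_n,L_{n-1}\rangle$, $M_n=\langle x_n,y_n,z_n,L_{n-1}\rangle\le\mathrm{Aut}(\mathcal T_n)$. -}

module Defs where

open import Data.Nat using (ℕ; zero; suc)
open import Data.Fin using (Fin; zero; suc)
open import Data.Unit using (⊤; tt)
open import Data.Sum using (_⊎_)
open import Data.Product using (Σ; _×_)
open import Data.List using (List; length)
open import Data.List.Relation.Unary.Unique.Propositional using (Unique)
open import Data.List.Membership.Propositional using (_∈_)
open import Function.Bundles using (_⇔_)
open import Relation.Binary.PropositionalEquality using (_≡_; refl)

data S3 : Set where
  e c012 c021 t01 t02 t12 : S3

-- Right action: (i)π
act : S3 → Fin 3 → Fin 3
act e    i = i
act c012 zero = suc zero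
act c012 (suc zero) = suc (suc zero)
act c012 (suc (suc zero)) = zero
act c021 zero = suc (suc zero)
act c021 (suc zero) = zero
act c021 (suc (suc zero)) = suc zero
act t01 zero = suc zero
act t01 (suc zero) = zero
act t01 (suc (suc zero)) = suc (suc zero)
act t02 zero = suc (suc zero)
act t02 (suc zero) = suc zero
act t02 (suc (suc zero)) = zero
act t12 zero = zero
act t12 (suc zero) = suc (suc zero)
act t12 (suc (suc zero)) = suc zero

-- The permutation determined by the images a of 0 and b of 1
-- (non-injective inputs are never used).
fromImg : Fin 3 → Fin 3 → S3
fromImg zero (suc zero) = e
fromImg zero (suc (suc zero)) = t12
fromImg (suc zero) zero = t01
fromImg (suc zero) (suc (suc zero)) = c012
fromImg (suc (suc zero)) zero = c021
fromImg (suc (suc zero)) (suc zero) = t02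
fromImg _ _ = e

-- πρ : first π, then ρ
_⊙_ : S3 → S3 → S3
π ⊙ ρ = fromImg (act ρ (act π zero)) (act ρ (act π (suc zero)))

inv3 : S3 → S3
inv3 c012 = c021
inv3 c021 = c012
inv3 π    = π

⊙-act : ∀ π ρ i → act (π ⊙ ρ) i ≡ act ρ (act π i)
⊙-act e e zero = refl
⊙-act e e (suc zero) = refl
⊙-act e e (suc (suc zero)) = refl
⊙-act e c012 zero = refl
⊙-act e c012 (suc zero) = refl
⊙-act e c012 (suc (suc zero)) = refl
⊙-act e c021 zero = refl
⊙-act e c021 (suc zero) = refl
⊙-act e c021 (suc (suc zero)) = refl
⊙-act e t01 zero = refl
⊙-act e t01 (suc zero) = refl
⊙-act e t01 (suc (suc zero)) = refl
⊙-act e t02 zero = refl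
⊙-act e t02 (suc zero) = refl
⊙-act e t02 (suc (suc zero)) = refl
⊙-act e t12 zero = refl
⊙-act e t12 (suc zero) = refl
⊙-act e t12 (suc (suc zero)) = refl
⊙-act c012 e zero = refl
⊙-act c012 e (suc zero) = refl
⊙-act c012 e (suc (suc zero)) = refl
⊙-act c012 c012 zero = refl
⊙-act c012 c012 (suc zero) = refl
⊙-act c012 c012 (suc (suc zero)) = refl
⊙-act c012 c021 zero = refl
⊙-act c012 c021 (suc zero) = refl
⊙-act c012 c021 (suc (suc zero)) = refl
⊙-act c012 t01 zero = refl
⊙-act c012 t01 (suc zero) = refl
⊙-act c012 t01 (suc (suc zero)) = refl
⊙-act c012 t02 zero = refl
⊙-act c012 t02 (suc zero) = refl
⊙-act c012 t02 (suc (suc zero)) = refl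
⊙-act c012 t12 zero = refl
⊙-act c012 t12 (suc zero) = refl
⊙-act c012 t12 (suc (suc zero)) = refl
⊙-act c021 e zero = refl
⊙-act c021 e (suc zero) = refl
⊙-act c021 e (suc (suc zero)) = refl
⊙-act c021 c012 zero = refl
⊙-act c021 c012 (suc zero) = refl
⊙-act c021 c012 (suc (suc zero)) = refl
⊙-act c021 c021 zero = refl
⊙-act c021 c021 (suc zero) = refl
⊙-act c021 c021 (suc (suc zero)) = refl
⊙-act c021 t01 zero = refl
⊙-act c021 t01 (suc zero) = refl
⊙-act c021 t01 (suc (suc zero)) = refl
⊙-act c021 t02 zero = refl
⊙-act c021 t02 (suc zero) = refl
⊙-act c021 t02 (suc (suc zero)) = refl
⊙-act c021 t12 zero = refl
⊙-act c021 t12 (suc zero) = refl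
⊙-act c021 t12 (suc (suc zero)) = refl
⊙-act t01 e zero = refl
⊙-act t01 e (suc zero) = refl
⊙-act t01 e (suc (suc zero)) = refl
⊙-act t01 c012 zero = refl
⊙-act t01 c012 (suc zero) = refl
⊙-act t01 c012 (suc (suc zero)) = refl
⊙-act t01 c021 zero = refl
⊙-act t01 c021 (suc zero) = refl
⊙-act t01 c021 (suc (suc zero)) = refl
⊙-act t01 t01 zero = refl
⊙-act t01 t01 (suc zero) = refl
⊙-act t01 t01 (suc (suc zero)) = refl
⊙-act t01 t02 zero = refl
⊙-act t01 t02 (suc zero) = refl
⊙-act t01 t02 (suc (suc zero)) = refl
⊙-act t01 t12 zero = refl
⊙-act t01 t12 (suc zero) = refl
⊙-act t01 t12 (suc (suc zero)) = refl
⊙-act t02 e zero = refl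
⊙-act t02 e (suc zero) = refl
⊙-act t02 e (suc (suc zero)) = refl
⊙-act t02 c012 zero = refl
⊙-act t02 c012 (suc zero) = refl
⊙-act t02 c012 (suc (suc zero)) = refl
⊙-act t02 c021 zero = refl
⊙-act t02 c021 (suc zero) = refl
⊙-act t02 c021 (suc (suc zero)) = refl
⊙-act t02 t01 zero = refl
⊙-act t02 t01 (suc zero) = refl
⊙-act t02 t01 (suc (suc zero)) = refl
⊙-act t02 t02 zero = refl
⊙-act t02 t02 (suc zero) = refl
⊙-act t02 t02 (suc (suc zero)) = refl
⊙-act t02 t12 zero = refl
⊙-act t02 t12 (suc zero) = refl
⊙-act t02 t12 (suc (suc zero)) = refl
⊙-act t12 e zero = refl
⊙-act t12 e (suc zero) = refl
⊙-act t12 e (suc (suc zero)) = refl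
⊙-act t12 c012 zero = refl
⊙-act t12 c012 (suc zero) = refl
⊙-act t12 c012 (suc (suc zero)) = refl
⊙-act t12 c021 zero = refl
⊙-act t12 c021 (suc zero) = refl
⊙-act t12 c021 (suc (suc zero)) = refl
⊙-act t12 t01 zero = refl
⊙-act t12 t01 (suc zero) = refl
⊙-act t12 t01 (suc (suc zero)) = refl
⊙-act t12 t02 zero = refl
⊙-act t12 t02 (suc zero) = refl
⊙-act t12 t02 (suc (suc zero)) = refl
⊙-act t12 t12 zero = refl
⊙-act t12 t12 (suc zero) = refl
⊙-act t12 t12 (suc (suc zero)) = refl

inv3-act : ∀ π i → act (inv3 π) (act π i) ≡ i
inv3-act e i = refl
inv3-act c012 zero = refl
inv3-act c012 (suc zero) = refl
inv3-act c012 (suc (suc zero)) = refl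
inv3-act c021 zero = refl
inv3-act c021 (suc zero) = refl
inv3-act c021 (suc (suc zero)) = refl
inv3-act t01 zero = refl
inv3-act t01 (suc zero) = refl
inv3-act t01 (suc (suc zero)) = refl
inv3-act t02 zero = refl
inv3-act t02 (suc zero) = refl
inv3-act t02 (suc (suc zero)) = refl
inv3-act t12 zero = refl
inv3-act t12 (suc zero) = refl
inv3-act t12 (suc (suc zero)) = refl

-- Aut(T_n), via the wreath recursion σ = (σ₀,σ₁,σ₂)π.
-- Aut(T_0) is trivial; Aut(T_1) = {(tt,tt,tt)π} ≅ S₃.

data Aut : ℕ → Set where
  leaf : Aut zero
  node : ∀ {n} → Aut n → Aut n → Aut n → S3 → Aut (suc n)

child : ∀ {n} → Aut (suc n) → Fin 3 → Aut n
child (node s₀ s₁ s₂ π) zero = s₀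
child (node s₀ s₁ s₂ π) (suc zero) = s₁
child (node s₀ s₁ s₂ π) (suc (suc zero)) = s₂

idA : ∀ {n} → Aut n
idA {zero} = leaf
idA {suc n} = node idA idA idA e

-- (σᵢ)π · (τᵢ)ρ = (σᵢ τ_{(i)π}) πρ    (first σ, then τ)
infixl 7 _·_
_·_ : ∀ {n} → Aut n → Aut n → Aut n
leaf · leaf = leaf
node s₀ s₁ s₂ π · τ@(node _ _ _ ρ) =
  node (s₀ · child τ (act π zero))
       (s₁ · child τ (act π (suc zero)))
       (s₂ · child τ (act π (suc (suc zero))))
       (π ⊙ ρ)

invA : ∀ {n} → Aut n → Aut n
invA leaf = leaf
invA σ@(node _ _ _ π) =
  node (invA (child σ (act (inv3 π) zero)))
       (invA (child σ (act (inv3 π) (suc zero))))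
       (invA (child σ (act (inv3 π) (suc (suc zero)))))
       (inv3 π)

embed : ∀ {n} → Aut n → Aut (suc n)
embed σ = node σ idA idA e

data ⟨_⟩ {n} (S : Aut n → Set) : Aut n → Set where
  gen : ∀ {g} → S g → ⟨ S ⟩ g
  one : ⟨ S ⟩ idA
  mul : ∀ {g h} → ⟨ S ⟩ g → ⟨ S ⟩ h → ⟨ S ⟩ (g · h)
  inv : ∀ {g} → ⟨ S ⟩ g → ⟨ S ⟩ (invA g)

-- The elements x_n, y_n, z_n  (for n ≥ 1; the value at n = 0 is the
-- trivial automorphism, and with it the uniform recursion below gives
-- exactly x₁ = (0,1,2), y₁ = (0,1), z₁ = id at n = 1).

x : (n : ℕ) → Aut n
x zero = leaf
x (suc n) = node idA idA (x n) c012

y : (n : ℕ) → Aut n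
y zero = leaf
y (suc n) = node idA (y n) (x n) t01

z : (n : ℕ) → Aut n
z zero = leaf
z (suc n) = node (y n) (y n) (x n) e

x₁-ok : x 1 ≡ node leaf leaf leaf c012
x₁-ok = refl
y₁-ok : y 1 ≡ node leaf leaf leaf t01
y₁-ok = refl
z₁-ok : z 1 ≡ idA
z₁-ok = refl

-- The groups L_n and M_n (as predicates on Aut(T_n)); only n ≥ 1 is
-- meaningful, level 0 is a dummy value.

L : (n : ℕ) → Aut n → Set
L zero _ = ⊤
L (suc zero) = ⟨ (λ g → g ≡ x 1) ⟩
L (suc (suc n)) = ⟨ (λ g → g ≡ x (suc (suc n))
                          ⊎ g ≡ z (suc (suc n))
                          ⊎ Σ (Aut (suc n)) (λ h → L (suc n) h × g ≡ embed h)) ⟩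

M : (n : ℕ) → Aut n → Set
M zero _ = ⊤
M (suc zero) _ = ⊤                    -- M₁ = S₃ = Aut(T₁)
M (suc (suc n)) = ⟨ (λ g → g ≡ x (suc (suc n))
                          ⊎ g ≡ y (suc (suc n))
                          ⊎ g ≡ z (suc (suc n))
                          ⊎ Σ (Aut (suc n)) (λ h → L (suc n) h × g ≡ embed h)) ⟩

HasCard : ∀ {n} → (Aut n → Set) → ℕ → Set
HasCard {n} P k =
  Σ (List (Aut n)) λ xs → Unique xs × (∀ g → (g ∈ xs) ⇔ P g) × length xs ≡ k

{-# OPTIONS --safe #-}
-- Call g ∈ Aut(T_n) balanced if at every vertex above level n-1 the sign of the
-- local permutation equals the sum mod 2 of the signs at its three children.
-- Balanced automorphisms form a group containing x_n, y_n, z_n and L_{n-1}, so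
-- M_n consists of balanced automorphisms. Conversely, by induction on n, L_n is
-- exactly the even balanced automorphisms and M_n all balanced ones. Conjugating
-- (a,1,1), a ∈ L_{n-1}, by the rotation (1,1,1)(0,1,2) = x_n · (x_{n-1}⁻¹,1,1)
-- yields every (a,b,c) with a,b,c ∈ L_{n-1}. A balanced (a,b,c) has an even
-- number of odd children, so it lies in L_{n-1}³ · (r_a,r_b,r_c) with r = x_{n-1}
-- on even and r = y_{n-1} on odd children, and (x,x,x), z_n = (y,y,x) and the
-- rotations of z_n lie in the group. Finally y_n supplies the odd elements.
-- Counting balanced automorphisms is then a free choice of 6 permutations at each
-- of the 3^{n-1} vertices of level n-1 and of 3 permutations of prescribed sign
-- at each of the (3^{n-1}-1)/2 vertices above.
module Submission where

open import Defs

open import Algebra.Bundles using (Group; CommutativeRing)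
open import Algebra.Structures using (IsGroup)
import Algebra.Properties.Group as GroupProperties
open import Data.Bool using (Bool; true; false; _xor_)
import Data.Bool as Bool
open import Data.Bool.Properties using (xor-∧-commutativeRing; xor-same)
open import Algebra.Properties.CommutativeMonoid.Sum (CommutativeRing.+-commutativeMonoid xor-∧-commutativeRing)
  using (sum-syntax; ∑-distrib-+; sum-permute; sum-cong-≗)
open import Data.Fin using (Fin)
open import Data.Fin.Patterns using (0F; 1F; 2F)
open import Data.Fin.Permutation using (Permutation)
open import Data.List using (List; []; _∷_; _++_; length; map; allFin; cartesianProductWith; cartesianProduct)
open import Data.List.Properties using (length-++; length-map)
open import Data.List.Membership.Propositional using (_∈_)
open import Data.List.Membership.Propositional.Properties
  using ( ∈-map⁺; ∈-allFin; ∈-cartesianProductWith⁺; ∈-cartesianProductWith⁻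
        ; ∈-cartesianProduct⁺; ∈-cartesianProduct⁻)
open import Data.List.Relation.Unary.All as All using (All; []; _∷_; all?)
open import Data.List.Relation.Unary.AllPairs using ([]; _∷_)
open import Data.List.Relation.Unary.Any using (here; there)
open import Data.List.Relation.Unary.Unique.Propositional using (Unique)
import Data.List.Relation.Unary.Unique.Propositional.Properties as Unique
open import Data.Nat using (ℕ; zero; suc; _+_; _*_; _^_; _∸_; _≤_)
open import Data.Nat.DivMod using (_/_; m*n/n≡m)
open import Data.Nat.Properties using (*-comm; ^-*-assoc)
open import Data.Nat.Tactic.RingSolver using (solve-∀)
open import Data.Product using (_×_; _,_; proj₂)
open import Data.Sum using (inj₁; inj₂)
open import Data.Unit using (⊤; tt)
open import Function using (_∘_)
open import Function.Bundles using (_⇔_; mk⇔; mk↔ₛ′)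
open import Function.Construct.Composition using (_⇔-∘_)
open import Level using (0ℓ)
open import Relation.Binary.PropositionalEquality
  using (_≡_; refl; sym; trans; cong; cong₂; subst; isEquivalence; module ≡-Reasoning)
open import Relation.Nullary.Decidable using (toWitness)

open ≡-Reasoning

sgn : S3 → Bool
sgn e = false
sgn c012 = false
sgn c021 = false
sgn t01 = true
sgn t02 = true
sgn t12 = true

fromImg-act : ∀ π → fromImg (act π 0F) (act π 1F) ≡ π
fromImg-act e = refl
fromImg-act c012 = refl
fromImg-act c021 = refl
fromImg-act t01 = refl
fromImg-act t02 = refl
fromImg-act t12 = refl

⊙-identityˡ : ∀ π → e ⊙ π ≡ π
⊙-identityˡ = fromImg-act

⊙-identityʳ : ∀ π → π ⊙ e ≡ π
⊙-identityʳ = fromImg-act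

-- A permutation of X is determined by the images of 0 and 1.
⊙-assoc : ∀ π ρ κ → (π ⊙ ρ) ⊙ κ ≡ π ⊙ (ρ ⊙ κ)
⊙-assoc π ρ κ = cong₂ fromImg (image 0F) (image 1F)
  where
  image : ∀ i → act κ (act (π ⊙ ρ) i) ≡ act (ρ ⊙ κ) (act π i)
  image i = trans (cong (act κ) (⊙-act π ρ i)) (sym (⊙-act ρ κ (act π i)))

inv3-involutive : ∀ π → inv3 (inv3 π) ≡ π
inv3-involutive e = refl
inv3-involutive c012 = refl
inv3-involutive c021 = refl
inv3-involutive t01 = refl
inv3-involutive t02 = refl
inv3-involutive t12 = refl

inv3-inverseˡ : ∀ π → inv3 π ⊙ π ≡ e
inv3-inverseˡ e = refl
inv3-inverseˡ c012 = refl
inv3-inverseˡ c021 = refl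
inv3-inverseˡ t01 = refl
inv3-inverseˡ t02 = refl
inv3-inverseˡ t12 = refl

inv3-inverseʳ : ∀ π → π ⊙ inv3 π ≡ e
inv3-inverseʳ π = subst (λ σ → σ ⊙ inv3 π ≡ e) (inv3-involutive π) (inv3-inverseˡ (inv3 π))

act-inv3 : ∀ π i → act π (act (inv3 π) i) ≡ i
act-inv3 π i = subst (λ σ → act σ (act (inv3 π) i) ≡ i) (inv3-involutive π) (inv3-act (inv3 π) i)

act-permutation : S3 → Permutation 3 3
act-permutation π = mk↔ₛ′ (act π) (act (inv3 π)) (act-inv3 π) (inv3-act π)

sgn-inv3 : ∀ π → sgn (inv3 π) ≡ sgn π
sgn-inv3 e = refl
sgn-inv3 c012 = refl
sgn-inv3 c021 = refl
sgn-inv3 t01 = refl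
sgn-inv3 t02 = refl
sgn-inv3 t12 = refl

allS3 : List S3
allS3 = e ∷ c012 ∷ c021 ∷ t01 ∷ t02 ∷ t12 ∷ []

∈-allS3 : ∀ π → π ∈ allS3
∈-allS3 e = here refl
∈-allS3 c012 = there (here refl)
∈-allS3 c021 = there (there (here refl))
∈-allS3 t01 = there (there (there (here refl)))
∈-allS3 t02 = there (there (there (there (here refl))))
∈-allS3 t12 = there (there (there (there (there (here refl)))))

allS3-unique : Unique allS3
allS3-unique = ((λ ()) ∷ (λ ()) ∷ (λ ()) ∷ (λ ()) ∷ (λ ()) ∷ [])
             ∷ ((λ ()) ∷ (λ ()) ∷ (λ ()) ∷ (λ ()) ∷ [])
             ∷ ((λ ()) ∷ (λ ()) ∷ (λ ()) ∷ [])
             ∷ ((λ ()) ∷ (λ ()) ∷ [])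
             ∷ ((λ ()) ∷ [])
             ∷ [] ∷ []

sgn-⊙ : ∀ π ρ → sgn (π ⊙ ρ) ≡ sgn π xor sgn ρ
sgn-⊙ π ρ = All.lookup (All.lookup table (∈-allS3 π)) (∈-allS3 ρ)
  where
  table : All (λ π → All (λ ρ → sgn (π ⊙ ρ) ≡ sgn π xor sgn ρ) allS3) allS3
  table = toWitness {a? = all? (λ π → all? (λ ρ → sgn (π ⊙ ρ) Bool.≟ sgn π xor sgn ρ) allS3) allS3} tt

root : ∀ {n} → Aut (suc n) → S3
root (node _ _ _ π) = π

node-cong : ∀ {n} {a a′ b b′ c c′ : Aut n} {π π′ : S3} →
            a ≡ a′ → b ≡ b′ → c ≡ c′ → π ≡ π′ → node a b c π ≡ node a′ b′ c′ π′
node-cong refl refl refl refl = refl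

child-idA : ∀ {n} j → child (idA {suc n}) j ≡ idA
child-idA 0F = refl
child-idA 1F = refl
child-idA 2F = refl

child-· : ∀ {n} (σ τ : Aut (suc n)) j → child (σ · τ) j ≡ child σ j · child τ (act (root σ) j)
child-· (node _ _ _ _) (node _ _ _ _) 0F = refl
child-· (node _ _ _ _) (node _ _ _ _) 1F = refl
child-· (node _ _ _ _) (node _ _ _ _) 2F = refl

child-invA : ∀ {n} (σ : Aut (suc n)) j → child (invA σ) j ≡ invA (child σ (act (inv3 (root σ)) j))
child-invA (node _ _ _ _) 0F = refl
child-invA (node _ _ _ _) 1F = refl
child-invA (node _ _ _ _) 2F = refl

·-assoc : ∀ n (σ τ υ : Aut n) → (σ · τ) · υ ≡ σ · (τ · υ)
·-assoc zero leaf leaf leaf = refl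
·-assoc (suc n) σ@(node _ _ _ π) τ@(node _ _ _ ρ) υ@(node _ _ _ κ) =
  node-cong (component 0F) (component 1F) (component 2F) (⊙-assoc π ρ κ)
  where
  component : ∀ i → (child σ i · child τ (act π i)) · child υ (act (π ⊙ ρ) i)
                  ≡ child σ i · child (τ · υ) (act π i)
  component i = begin
    (child σ i · child τ (act π i)) · child υ (act (π ⊙ ρ) i)
      ≡⟨ cong (λ k → (child σ i · child τ (act π i)) · child υ k) (⊙-act π ρ i) ⟩
    (child σ i · child τ (act π i)) · child υ (act ρ (act π i))
      ≡⟨ ·-assoc n (child σ i) _ _ ⟩
    child σ i · (child τ (act π i) · child υ (act ρ (act π i)))
      ≡⟨ cong (child σ i ·_) (child-· τ υ (act π i)) ⟨
    child σ i · child (τ · υ) (act π i) ∎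

·-identityˡ : ∀ n (σ : Aut n) → idA · σ ≡ σ
·-identityˡ zero leaf = refl
·-identityˡ (suc n) (node a b c π) =
  node-cong (·-identityˡ n a) (·-identityˡ n b) (·-identityˡ n c) (⊙-identityˡ π)

·-identityʳ : ∀ n (σ : Aut n) → σ · idA ≡ σ
·-identityʳ zero leaf = refl
·-identityʳ (suc n) σ@(node _ _ _ π) =
  node-cong (component 0F) (component 1F) (component 2F) (⊙-identityʳ π)
  where
  component : ∀ i → child σ i · child (idA {suc n}) (act π i) ≡ child σ i
  component i = trans (cong (child σ i ·_) (child-idA (act π i))) (·-identityʳ n (child σ i))

·-inverseˡ : ∀ n (σ : Aut n) → invA σ · σ ≡ idA
·-inverseˡ zero leaf = refl
·-inverseˡ (suc n) σ@(node _ _ _ π) =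
  node-cong (·-inverseˡ n _) (·-inverseˡ n _) (·-inverseˡ n _) (inv3-inverseˡ π)

·-inverseʳ : ∀ n (σ : Aut n) → σ · invA σ ≡ idA
·-inverseʳ zero leaf = refl
·-inverseʳ (suc n) σ@(node _ _ _ π) =
  node-cong (component 0F) (component 1F) (component 2F) (inv3-inverseʳ π)
  where
  component : ∀ i → child σ i · child (invA σ) (act π i) ≡ idA
  component i = begin
    child σ i · child (invA σ) (act π i)
      ≡⟨ cong (child σ i ·_) (child-invA σ (act π i)) ⟩
    child σ i · invA (child σ (act (inv3 π) (act π i)))
      ≡⟨ cong (λ k → child σ i · invA (child σ k)) (inv3-act π i) ⟩
    child σ i · invA (child σ i)
      ≡⟨ ·-inverseʳ n (child σ i) ⟩
    idA ∎

Aut-isGroup : ∀ n → IsGroup _≡_ (_·_ {n}) idA invA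
Aut-isGroup n = record
  { isMonoid = record
    { isSemigroup = record
      { isMagma = record { isEquivalence = isEquivalence ; ∙-cong = cong₂ _·_ }
      ; assoc = ·-assoc n
      }
    ; identity = ·-identityˡ n , ·-identityʳ n
    }
  ; inverse = ·-inverseˡ n , ·-inverseʳ n
  ; ⁻¹-cong = cong invA
  }

Aut-group : ℕ → Group 0ℓ 0ℓ
Aut-group n = record { isGroup = Aut-isGroup n }

module _ {n : ℕ} where
  open GroupProperties (Aut-group n) public using (ε⁻¹≈ε; //-rightDividesˡ)

record IsSubgroup {n} (P : Aut n → Set) : Set where
  field
    idA-closed : P idA
    ·-closed : ∀ {σ τ} → P σ → P τ → P (σ · τ)
    invA-closed : ∀ {σ} → P σ → P (invA σ)

⟨⟩-least : ∀ {n} {S P : Aut n → Set} → IsSubgroup P → (∀ {σ} → S σ → P σ) → ∀ {σ} → ⟨ S ⟩ σ → P σ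
⟨⟩-least P-sub S⊆P (gen s) = S⊆P s
⟨⟩-least P-sub S⊆P one = IsSubgroup.idA-closed P-sub
⟨⟩-least P-sub S⊆P (mul p q) = IsSubgroup.·-closed P-sub (⟨⟩-least P-sub S⊆P p) (⟨⟩-least P-sub S⊆P q)
⟨⟩-least P-sub S⊆P (inv p) = IsSubgroup.invA-closed P-sub (⟨⟩-least P-sub S⊆P p)

par : ∀ {n} → Aut (suc n) → Bool
par σ = sgn (root σ)

par-· : ∀ {n} (σ τ : Aut (suc n)) → par (σ · τ) ≡ par σ xor par τ
par-· (node _ _ _ π) (node _ _ _ ρ) = sgn-⊙ π ρ

par-invA : ∀ {n} (σ : Aut (suc n)) → par (invA σ) ≡ par σ
par-invA (node _ _ _ π) = sgn-inv3 π

Balanced : ∀ n → Aut n → Set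
Balanced zero _ = ⊤
Balanced (suc zero) _ = ⊤
Balanced (suc (suc n)) σ = (∀ j → Balanced (suc n) (child σ j)) × par σ ≡ ∑[ j < 3 ] par (child σ j)

par-children-· : ∀ {n} (σ τ : Aut (suc (suc n))) →
  ∑[ j < 3 ] par (child (σ · τ) j) ≡ (∑[ j < 3 ] par (child σ j)) xor (∑[ j < 3 ] par (child τ j))
par-children-· σ τ = begin
  ∑[ j < 3 ] par (child (σ · τ) j)
    ≡⟨ sum-cong-≗ (λ j → cong par (child-· σ τ j)) ⟩
  ∑[ j < 3 ] par (child σ j · child τ (act (root σ) j))
    ≡⟨ sum-cong-≗ (λ j → par-· (child σ j) (child τ (act (root σ) j))) ⟩
  ∑[ j < 3 ] (par (child σ j) xor par (child τ (act (root σ) j)))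
    ≡⟨ ∑-distrib-+ (par ∘ child σ) (par ∘ child τ ∘ act (root σ)) ⟩
  (∑[ j < 3 ] par (child σ j)) xor (∑[ j < 3 ] par (child τ (act (root σ) j)))
    ≡⟨ cong ((∑[ j < 3 ] par (child σ j)) xor_)
            (sum-permute (par ∘ child τ) (act-permutation (root σ))) ⟨
  (∑[ j < 3 ] par (child σ j)) xor (∑[ j < 3 ] par (child τ j)) ∎

par-children-invA : ∀ {n} (σ : Aut (suc (suc n))) →
  ∑[ j < 3 ] par (child (invA σ) j) ≡ ∑[ j < 3 ] par (child σ j)
par-children-invA σ = begin
  ∑[ j < 3 ] par (child (invA σ) j)
    ≡⟨ sum-cong-≗ (λ j → trans (cong par (child-invA σ j)) (par-invA (child σ (act (inv3 (root σ)) j)))) ⟩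
  ∑[ j < 3 ] par (child σ (act (inv3 (root σ)) j))
    ≡⟨ sum-permute (par ∘ child σ) (act-permutation (inv3 (root σ))) ⟨
  ∑[ j < 3 ] par (child σ j) ∎

Balanced-idA : ∀ n → Balanced n idA
Balanced-idA zero = tt
Balanced-idA (suc zero) = tt
Balanced-idA (suc (suc n)) =
  (λ j → subst (Balanced (suc n)) (sym (child-idA j)) (Balanced-idA (suc n))) , refl

Balanced-· : ∀ n {σ τ} → Balanced n σ → Balanced n τ → Balanced n (σ · τ)
Balanced-· zero _ _ = tt
Balanced-· (suc zero) _ _ = tt
Balanced-· (suc (suc n)) {σ} {τ} (σ-children , σ-par) (τ-children , τ-par) =
  (λ j → subst (Balanced (suc n)) (sym (child-· σ τ j))
                (Balanced-· (suc n) (σ-children j) (τ-children (act (root σ) j)))) ,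
  (begin
    par (σ · τ)                                                     ≡⟨ par-· σ τ ⟩
    par σ xor par τ                                                 ≡⟨ cong₂ _xor_ σ-par τ-par ⟩
    (∑[ j < 3 ] par (child σ j)) xor (∑[ j < 3 ] par (child τ j))  ≡⟨ par-children-· σ τ ⟨
    ∑[ j < 3 ] par (child (σ · τ) j)                                ∎)

Balanced-invA : ∀ n {σ} → Balanced n σ → Balanced n (invA σ)
Balanced-invA zero _ = tt
Balanced-invA (suc zero) _ = tt
Balanced-invA (suc (suc n)) {σ} (σ-children , σ-par) =
  (λ j → subst (Balanced (suc n)) (sym (child-invA σ j)) (Balanced-invA (suc n) (σ-children _))) ,
  trans (par-invA σ) (trans σ-par (sym (par-children-invA σ)))

Balanced-isSubgroup : ∀ n → IsSubgroup (Balanced n)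
Balanced-isSubgroup n = record
  { idA-closed = Balanced-idA n ; ·-closed = Balanced-· n ; invA-closed = Balanced-invA n }

EvenBalanced : ∀ n → Aut (suc n) → Set
EvenBalanced n σ = Balanced (suc n) σ × par σ ≡ false

EvenBalanced-isSubgroup : ∀ n → IsSubgroup (EvenBalanced n)
EvenBalanced-isSubgroup n = record
  { idA-closed = idA-closed , refl
  ; ·-closed = λ {σ} {τ} (σ-bal , σ-even) (τ-bal , τ-even) →
      ·-closed σ-bal τ-bal , trans (par-· σ τ) (cong₂ _xor_ σ-even τ-even)
  ; invA-closed = λ {σ} (σ-bal , σ-even) → invA-closed σ-bal , trans (par-invA σ) σ-even
  }
  where open IsSubgroup (Balanced-isSubgroup (suc n))

EvenBalanced-/ : ∀ {n} {σ τ} → Balanced (suc n) σ → Balanced (suc n) τ → par σ ≡ par τ →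
                 EvenBalanced n (σ · invA τ)
EvenBalanced-/ {n} {σ} {τ} σ-bal τ-bal same-par =
  ·-closed σ-bal (invA-closed τ-bal) ,
  (begin
    par (σ · invA τ)       ≡⟨ par-· σ (invA τ) ⟩
    par σ xor par (invA τ) ≡⟨ cong₂ _xor_ same-par (par-invA τ) ⟩
    par τ xor par τ        ≡⟨ xor-same (par τ) ⟩
    false                  ∎)
  where open IsSubgroup (Balanced-isSubgroup (suc n))

Balanced-node : ∀ {n a b c} π → Balanced (suc n) a → Balanced (suc n) b → Balanced (suc n) c →
                sgn π ≡ par a xor (par b xor (par c xor false)) → Balanced (suc (suc n)) (node a b c π)
Balanced-node {a = a} {b} {c} π a-bal b-bal c-bal π-par = children , π-par
  where
  children : ∀ j → Balanced _ (child (node a b c π) j)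
  children 0F = a-bal
  children 1F = b-bal
  children 2F = c-bal

Balanced-x : ∀ n → Balanced n (x n)
Balanced-x zero = tt
Balanced-x (suc zero) = tt
Balanced-x (suc (suc n)) =
  Balanced-node c012 (Balanced-idA (suc n)) (Balanced-idA (suc n)) (Balanced-x (suc n)) refl

Balanced-y : ∀ n → Balanced n (y n)
Balanced-y zero = tt
Balanced-y (suc zero) = tt
Balanced-y (suc (suc n)) =
  Balanced-node t01 (Balanced-idA (suc n)) (Balanced-y (suc n)) (Balanced-x (suc n)) refl

Balanced-z : ∀ n → Balanced n (z n)
Balanced-z zero = tt
Balanced-z (suc zero) = tt
Balanced-z (suc (suc n)) =
  Balanced-node e (Balanced-y (suc n)) (Balanced-y (suc n)) (Balanced-x (suc n)) refl

Balanced-embed : ∀ n {σ} → EvenBalanced n σ → Balanced (suc (suc n)) (embed σ)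
Balanced-embed n (σ-bal , σ-even) = Balanced-node e σ-bal (Balanced-idA (suc n)) (Balanced-idA (suc n))
  (cong (λ b → b xor (false xor (false xor false))) (sym σ-even))

L⊆EvenBalanced : ∀ n {σ} → L (suc n) σ → EvenBalanced n σ
L⊆EvenBalanced zero = ⟨⟩-least (EvenBalanced-isSubgroup zero) λ { refl → tt , refl }
L⊆EvenBalanced (suc n) = ⟨⟩-least (EvenBalanced-isSubgroup (suc n)) λ
  { (inj₁ refl) → Balanced-x (suc (suc n)) , refl
  ; (inj₂ (inj₁ refl)) → Balanced-z (suc (suc n)) , refl
  ; (inj₂ (inj₂ (_ , σ∈L , refl))) → Balanced-embed n (L⊆EvenBalanced n σ∈L) , refl
  }

M⊆Balanced : ∀ n {σ} → M (suc n) σ → Balanced (suc n) σ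
M⊆Balanced zero _ = tt
M⊆Balanced (suc n) = ⟨⟩-least (Balanced-isSubgroup (suc (suc n))) λ
  { (inj₁ refl) → Balanced-x (suc (suc n))
  ; (inj₂ (inj₁ refl)) → Balanced-y (suc (suc n))
  ; (inj₂ (inj₂ (inj₁ refl))) → Balanced-z (suc (suc n))
  ; (inj₂ (inj₂ (inj₂ (_ , σ∈L , refl)))) → Balanced-embed n (L⊆EvenBalanced n σ∈L)
  }

module Generation (n : ℕ) (EvenBalanced⊆L : ∀ {σ} → EvenBalanced n σ → L (suc n) σ)
  {S : Aut (suc (suc n)) → Set} (x∈S : S (x (suc (suc n)))) (z∈S : S (z (suc (suc n))))
  (embed∈S : ∀ {σ} → L (suc n) σ → S (embed σ)) where

  G : Aut (suc (suc n)) → Set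
  G = ⟨ S ⟩

  embed∈G : ∀ {σ} → EvenBalanced n σ → G (embed σ)
  embed∈G = gen ∘ embed∈S ∘ EvenBalanced⊆L

  X-even : EvenBalanced n (x (suc n))
  X-even = Balanced-x (suc n) , refl

  rotation : Aut (suc (suc n))
  rotation = node idA idA idA c012

  rotation∈G : G rotation
  rotation∈G = subst G (node-cong (·-identityˡ _ idA) (·-identityˡ _ idA) (·-inverseʳ _ (x (suc n))) refl)
    (mul (gen x∈S) (embed∈G (IsSubgroup.invA-closed (EvenBalanced-isSubgroup n) X-even)))

  rotate : ∀ {a b c} → G (node a b c e) → G (node b c a e)
  rotate {a} {b} {c} abc∈G =
    subst G (node-cong (conjugate b) (conjugate c) (conjugate a) refl)
      (mul (mul rotation∈G abc∈G) (inv rotation∈G))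
    where
    conjugate : ∀ σ → (idA · σ) · invA idA ≡ σ
    conjugate σ = trans (cong ((idA · σ) ·_) ε⁻¹≈ε) (trans (·-identityʳ _ _) (·-identityˡ _ σ))

  evenChildren∈G : ∀ {a b c} → EvenBalanced n a → EvenBalanced n b → EvenBalanced n c → G (node a b c e)
  evenChildren∈G {a} {b} {c} a-even b-even c-even =
    subst G (node-cong a-eq b-eq c-eq refl)
      (mul (mul (embed∈G a-even) (rotate (rotate (embed∈G b-even)))) (rotate (embed∈G c-even)))
    where
    a-eq : (a · idA) · idA ≡ a
    a-eq = trans (·-identityʳ _ _) (·-identityʳ _ a)
    b-eq : (idA · b) · idA ≡ b
    b-eq = trans (·-identityʳ _ _) (·-identityˡ _ b)
    c-eq : (idA · idA) · c ≡ c
    c-eq = trans (cong (_· c) (·-identityˡ _ idA)) (·-identityˡ _ c)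

  evenRoot∈G : ∀ π → sgn π ≡ false → G (node idA idA idA π)
  evenRoot∈G e _ = one
  evenRoot∈G c012 _ = rotation∈G
  evenRoot∈G c021 _ = subst G (node-cong (·-identityˡ _ idA) (·-identityˡ _ idA) (·-identityˡ _ idA) refl)
                        (mul rotation∈G rotation∈G)

  representative : Bool → Aut (suc n)
  representative false = x (suc n)
  representative true = y (suc n)

  par-representative : ∀ p → par (representative p) ≡ p
  par-representative false = refl
  par-representative true = refl

  Balanced-representative : ∀ p → Balanced (suc n) (representative p)
  Balanced-representative false = Balanced-x (suc n)
  Balanced-representative true = Balanced-y (suc n)

  representatives∈G : ∀ p q r → p xor (q xor (r xor false)) ≡ false →
                      G (node (representative p) (representative q) (representative r) e)
  representatives∈G false false false _ = evenChildren∈G X-even X-even X-even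
  representatives∈G true true false _ = gen z∈S
  representatives∈G true false true _ = rotate (gen z∈S)
  representatives∈G false true true _ = rotate (rotate (gen z∈S))

  balancedChildren∈G : ∀ {a b c} → Balanced (suc n) a → Balanced (suc n) b → Balanced (suc n) c →
                       par a xor (par b xor (par c xor false)) ≡ false → G (node a b c e)
  balancedChildren∈G {a} {b} {c} a-bal b-bal c-bal even =
    subst G (node-cong (//-rightDividesˡ _ a) (//-rightDividesˡ _ b) (//-rightDividesˡ _ c) refl)
      (mul (evenChildren∈G (quotient a-bal) (quotient b-bal) (quotient c-bal))
           (representatives∈G (par a) (par b) (par c) even))
    where
    quotient : ∀ {σ} → Balanced (suc n) σ → EvenBalanced n (σ · invA (representative (par σ)))
    quotient {σ} σ-bal =
      EvenBalanced-/ σ-bal (Balanced-representative (par σ)) (sym (par-representative (par σ)))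

  evenBalanced∈G : ∀ {σ} → EvenBalanced (suc n) σ → G σ
  evenBalanced∈G {node a b c π} ((children , π-par) , even) =
    subst G (node-cong (·-identityʳ _ a) (·-identityʳ _ b) (·-identityʳ _ c) (⊙-identityˡ π))
      (mul (balancedChildren∈G (children 0F) (children 1F) (children 2F) (trans (sym π-par) even))
           (evenRoot∈G π even))

  balanced∈G : S (y (suc (suc n))) → ∀ {σ} → Balanced (suc (suc n)) σ → G σ
  balanced∈G y∈S {σ} σ-bal = byParity (par σ) refl
    where
    byParity : ∀ p → par σ ≡ p → G σ
    byParity false even = evenBalanced∈G (σ-bal , even)
    byParity true odd = subst G (//-rightDividesˡ (y (suc (suc n))) σ)
      (mul (evenBalanced∈G (EvenBalanced-/ {σ = σ} {y (suc (suc n))} σ-bal (Balanced-y _) odd))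
           (gen y∈S))

EvenBalanced⊆L : ∀ n {σ} → EvenBalanced n σ → L (suc n) σ
EvenBalanced⊆L zero {node leaf leaf leaf e} _ = one
EvenBalanced⊆L zero {node leaf leaf leaf c012} _ = gen refl
EvenBalanced⊆L zero {node leaf leaf leaf c021} _ = mul (gen refl) (gen refl)
EvenBalanced⊆L (suc n) = Generation.evenBalanced∈G n (EvenBalanced⊆L n)
  (inj₁ refl) (inj₂ (inj₁ refl)) (λ σ∈L → inj₂ (inj₂ (_ , σ∈L , refl)))

Balanced⊆M : ∀ n {σ} → Balanced (suc n) σ → M (suc n) σ
Balanced⊆M zero _ = tt
Balanced⊆M (suc n) = Generation.balanced∈G n (EvenBalanced⊆L n)
  (inj₁ refl) (inj₂ (inj₂ (inj₁ refl))) (λ σ∈L → inj₂ (inj₂ (inj₂ (_ , σ∈L , refl))))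
  (inj₂ (inj₁ refl))

Balanced⇔M : ∀ n {σ} → Balanced (suc n) σ ⇔ M (suc n) σ
Balanced⇔M n = mk⇔ (Balanced⊆M n) (M⊆Balanced n)

ofSign : Bool → Fin 3 → S3
ofSign false 0F = e
ofSign false 1F = c012
ofSign false 2F = c021
ofSign true 0F = t01
ofSign true 1F = t02
ofSign true 2F = t12

index : S3 → Fin 3
index e = 0F
index c012 = 1F
index c021 = 2F
index t01 = 0F
index t02 = 1F
index t12 = 2F

ofSign-sgn-index : ∀ π → ofSign (sgn π) (index π) ≡ π
ofSign-sgn-index e = refl
ofSign-sgn-index c012 = refl
ofSign-sgn-index c021 = refl
ofSign-sgn-index t01 = refl
ofSign-sgn-index t02 = refl
ofSign-sgn-index t12 = refl

sgn-ofSign : ∀ s k → sgn (ofSign s k) ≡ s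
sgn-ofSign false 0F = refl
sgn-ofSign false 1F = refl
sgn-ofSign false 2F = refl
sgn-ofSign true 0F = refl
sgn-ofSign true 1F = refl
sgn-ofSign true 2F = refl

index-ofSign : ∀ s k → index (ofSign s k) ≡ k
index-ofSign false 0F = refl
index-ofSign false 1F = refl
index-ofSign false 2F = refl
index-ofSign true 0F = refl
index-ofSign true 1F = refl
index-ofSign true 2F = refl

length-cartesianProductWith : ∀ {A B C : Set} (f : A → B → C) xs ys →
                              length (cartesianProductWith f xs ys) ≡ length xs * length ys
length-cartesianProductWith f [] ys = refl
length-cartesianProductWith f (a ∷ xs) ys = begin
  length (map (f a) ys ++ cartesianProductWith f xs ys)
    ≡⟨ length-++ (map (f a) ys) ⟩
  length (map (f a) ys) + length (cartesianProductWith f xs ys)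
    ≡⟨ cong₂ _+_ (length-map (f a) ys) (length-cartesianProductWith f xs ys) ⟩
  length ys + length xs * length ys ∎

Triple : Set → Set
Triple A = (A × A) × A

triples : ∀ {A : Set} → List A → List (Triple A)
triples xs = cartesianProduct (cartesianProduct xs xs) xs

balancedNode : ∀ {n} → Triple (Aut (suc n)) → Fin 3 → Aut (suc (suc n))
balancedNode ((a , b) , c) k = node a b c (ofSign (par a xor (par b xor (par c xor false))) k)

node-injective : ∀ {n} {a a′ b b′ c c′ : Aut n} {π π′} → node a b c π ≡ node a′ b′ c′ π′ →
                 a ≡ a′ × b ≡ b′ × c ≡ c′ × π ≡ π′
node-injective refl = refl , refl , refl , refl

balancedNode-injective : ∀ {n} {t t′ : Triple (Aut (suc n))} {k k′} →
                         balancedNode t k ≡ balancedNode t′ k′ → t ≡ t′ × k ≡ k′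
balancedNode-injective {t = (a , b) , c} {(a′ , b′) , c′} {k} {k′} eq with node-injective eq
... | refl , refl , refl , root-eq =
  refl , trans (sym (index-ofSign _ k)) (trans (cong index root-eq) (index-ofSign _ k′))

enumerate : ∀ n → List (Aut (suc n))
enumerate zero = map (node leaf leaf leaf) allS3
enumerate (suc n) = cartesianProductWith balancedNode (triples (enumerate n)) (allFin 3)

enumerate-unique : ∀ n → Unique (enumerate n)
enumerate-unique zero =
  Unique.map⁺ {f = node leaf leaf leaf} (proj₂ ∘ proj₂ ∘ proj₂ ∘ node-injective) allS3-unique
enumerate-unique (suc n) = Unique.cartesianProductWith⁺ balancedNode balancedNode-injective
  (Unique.cartesianProduct⁺
    (Unique.cartesianProduct⁺ (enumerate-unique n) (enumerate-unique n))
    (enumerate-unique n))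
  (Unique.allFin⁺ 3)

∈-enumerate⁺ : ∀ n {σ} → Balanced (suc n) σ → σ ∈ enumerate n
∈-enumerate⁺ zero {node leaf leaf leaf π} _ = ∈-map⁺ (node leaf leaf leaf) (∈-allS3 π)
∈-enumerate⁺ (suc n) {node a b c π} (children , π-par) =
  subst (_∈ enumerate (suc n)) (cong (node a b c) root-eq)
    (∈-cartesianProductWith⁺ balancedNode
      (∈-cartesianProduct⁺
        (∈-cartesianProduct⁺ (∈-enumerate⁺ n (children 0F)) (∈-enumerate⁺ n (children 1F)))
        (∈-enumerate⁺ n (children 2F)))
      (∈-allFin (index π)))
  where
  root-eq : ofSign (par a xor (par b xor (par c xor false))) (index π) ≡ π
  root-eq = trans (cong (λ s → ofSign s (index π)) (sym π-par)) (ofSign-sgn-index π)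

∈-enumerate⁻ : ∀ n {σ} → σ ∈ enumerate n → Balanced (suc n) σ
∈-enumerate⁻ zero _ = tt
∈-enumerate⁻ (suc n) σ∈ with ∈-cartesianProductWith⁻ balancedNode (triples (enumerate n)) (allFin 3) σ∈
... | ((a , b) , c) , k , abc∈ , _ , refl
    with ∈-cartesianProduct⁻ (cartesianProduct (enumerate n) (enumerate n)) (enumerate n) abc∈
... | ab∈ , c∈ with ∈-cartesianProduct⁻ (enumerate n) (enumerate n) ab∈
... | a∈ , b∈ =
  Balanced-node (ofSign _ k) (∈-enumerate⁻ n a∈) (∈-enumerate⁻ n b∈) (∈-enumerate⁻ n c∈) (sgn-ofSign _ k)

balancedCount : ℕ → ℕ
balancedCount zero = 6
balancedCount (suc n) = balancedCount n * balancedCount n * balancedCount n * 3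

length-enumerate : ∀ n → length (enumerate n) ≡ balancedCount n
length-enumerate zero = refl
length-enumerate (suc n) = begin
  length (cartesianProductWith balancedNode (triples (enumerate n)) (allFin 3))
    ≡⟨ length-cartesianProductWith balancedNode (triples (enumerate n)) (allFin 3) ⟩
  length (triples (enumerate n)) * 3
    ≡⟨ cong (_* 3) (length-cartesianProductWith _,_ (cartesianProduct (enumerate n) (enumerate n)) (enumerate n)) ⟩
  length (cartesianProduct (enumerate n) (enumerate n)) * length (enumerate n) * 3
    ≡⟨ cong (λ l → l * length (enumerate n) * 3) (length-cartesianProductWith _,_ (enumerate n) (enumerate n)) ⟩
  length (enumerate n) * length (enumerate n) * length (enumerate n) * 3
    ≡⟨ cong (λ l → l * l * l * 3) (length-enumerate n) ⟩
  balancedCount n * balancedCount n * balancedCount n * 3 ∎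

repunit : ℕ → ℕ
repunit zero = 1
repunit (suc n) = 1 + 3 * repunit n

3^suc≡1+repunit*2 : ∀ n → 3 ^ suc n ≡ 1 + repunit n * 2
3^suc≡1+repunit*2 zero = refl
3^suc≡1+repunit*2 (suc n) = trans (cong (3 *_) (3^suc≡1+repunit*2 n)) (step (repunit n))
  where
  step : ∀ r → 3 * (1 + r * 2) ≡ 1 + (1 + 3 * r) * 2
  step = solve-∀

[3^suc∸1]/2≡repunit : ∀ n → (3 ^ suc n ∸ 1) / 2 ≡ repunit n
[3^suc∸1]/2≡repunit n = trans (cong (λ m → (m ∸ 1) / 2) (3^suc≡1+repunit*2 n)) (m*n/n≡m (repunit n) 2)

balancedCount≡ : ∀ n → balancedCount n ≡ 3 ^ repunit n * 2 ^ 3 ^ n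
balancedCount≡ zero = refl
balancedCount≡ (suc n) = begin
  balancedCount n * balancedCount n * balancedCount n * 3
    ≡⟨ cong (λ c → c * c * c * 3) (balancedCount≡ n) ⟩
  p * q * (p * q) * (p * q) * 3
    ≡⟨ cube p q ⟩
  3 * p ^ 3 * q ^ 3
    ≡⟨ cong₂ (λ u v → 3 * u * v) (^-*-assoc 3 r 3) (^-*-assoc 2 (3 ^ n) 3) ⟩
  3 * 3 ^ (r * 3) * 2 ^ (3 ^ n * 3)
    ≡⟨ cong₂ (λ u v → 3 * 3 ^ u * 2 ^ v) (*-comm r 3) (*-comm (3 ^ n) 3) ⟩
  3 ^ repunit (suc n) * 2 ^ 3 ^ suc n ∎
  where
  r p q : ℕ
  r = repunit n
  p = 3 ^ r
  q = 2 ^ 3 ^ n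
  cube : ∀ p q → p * q * (p * q) * (p * q) * 3 ≡ 3 * (p * (p * (p * 1))) * (q * (q * (q * 1)))
  cube = solve-∀

balancedCount-closed : ∀ n → balancedCount n ≡ 3 ^ ((3 ^ suc n ∸ 1) / 2) * 2 ^ 3 ^ n
balancedCount-closed n =
  trans (balancedCount≡ n) (cong (λ k → 3 ^ k * 2 ^ 3 ^ n) (sym ([3^suc∸1]/2≡repunit n)))

theorem3p21 : (n : ℕ) → 1 ≤ n →
    HasCard (M n) ((3 ^ ((3 ^ n ∸ 1) / 2)) * (2 ^ (3 ^ (n ∸ 1))))
theorem3p21 zero ()
theorem3p21 (suc n) _ =
  enumerate n ,
  enumerate-unique n ,
  (λ σ → Balanced⇔M n ⇔-∘ mk⇔ (∈-enumerate⁻ n) (∈-enumerate⁺ n)) ,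
  trans (length-enumerate n) (balancedCount-closed n)
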